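{- Let $m$ be a positive integer and $\lambda$ a nonzero real number. For integers $n\ge1$ and $0\le k\le n$, $$W_{m,\lambda}(n,k)=W_{m,\lambda}(n-1,k-1)+(mk+1)W_{m,\lambda}(n-1,k)-\lambda(n-1)W_{m,\lambda}(n-1,k),$$ with the convention $W_{m,\lambda}(n-1,-1)=0$ and $W_{m,\lambda}(n-1,n)=0$.
   Context: For a nonzero real $\lambda$: $(x)_{0,\lambda}=1$, $(x)_{n,\lambda}=x(x-\lambda)\cdots(x-(n-1)\lambda)$ for $n\ge1$; $(x)_n=(x)_{n,1}$. The degenerate Whitney numbers of the second kind $W_{m,\lambda}(n,k)$ are defined by $(mx+1)_{n,\lambda}=\sum_{k=0}^{n}W_{m,\lambda}(n,k)m^{k}(x)_{k}$ for $n\ge0$, and $W_{m,\lambda}(n,k)=0$ if $k<0$ or $k>n$. -}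

module Defs where

open import Level using (_⊔_)
open import Algebra.Bundles using (CommutativeRing)
open import Data.Nat using (ℕ; zero; suc; _<_)
open import Data.Product using (_×_)
open import Data.Sum using (_⊎_)
open import Relation.Nullary using (¬_)

module _ {c ℓ} (R : CommutativeRing c ℓ) where
  open CommutativeRing R

  ι : ℕ → Carrier
  ι zero = 0#
  ι (suc n) = 1# + ι n

  pow : Carrier → ℕ → Carrier
  pow a zero = 1#
  pow a (suc k) = pow a k * a

  sumTo : ℕ → (ℕ → Carrier) → Carrier
  sumTo zero f = f 0
  sumTo (suc n) f = sumTo n f + f (suc n)

  fallλ : Carrier → Carrier → ℕ → Carrier
  fallλ x lam zero = 1#
  fallλ x lam (suc n) = fallλ x lam n * (x - ι n * lam)

  fall : Carrier → ℕ → Carrier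
  fall x n = fallλ x 1# n

  -- R is an integral domain of characteristic zero (as the reals are)
  IntegralDomainChar0 : Set (c ⊔ ℓ)
  IntegralDomainChar0 =
    (∀ x y → x * y ≈ 0# → x ≈ 0# ⊎ y ≈ 0#) × (∀ n → ¬ (ι (suc n) ≈ 0#))

  -- W is the family of degenerate Whitney numbers of the second kind W_{m,λ}(n,k):
  -- W n k = 0 for k > n, and for all n and all x,
  -- (m x + 1)_{n,λ} = Σ_{k=0}^{n} W n k m^k (x)_k.
  IsDegWhitney2 : ℕ → Carrier → (ℕ → ℕ → Carrier) → Set (c ⊔ ℓ)
  IsDegWhitney2 m lam W =
    (∀ n k → n < k → W n k ≈ 0#) ×
    (∀ n x → fallλ (ι m * x + 1#) lam n
               ≈ sumTo n (λ k → W n k * pow (ι m) k * fall x k))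

  Wpred : (ℕ → ℕ → Carrier) → ℕ → ℕ → Carrier
  Wpred W n zero = 0#
  Wpred W n (suc k) = W n k

-- Multiplying (mx+1)_{n,λ} = Σ_k W(n,k) m^k (x)_k by mx + 1 - nλ and using
-- x (x)_k = (x)_{k+1} + k (x)_k expands (mx+1)_{n+1,λ} in the basis m^k (x)_k
-- with the right-hand side of the recurrence as coefficients. In an integral
-- domain of characteristic 0 the falling factorials are linearly independent as
-- functions (evaluate at x = 0, 1, …: the system is triangular), and m^k ≠ 0, so
-- these coefficients are the W(n+1,k).
module Submission where

open import Algebra.Bundles using (CommutativeRing)
import Algebra.Properties.CommutativeSemigroup as CommutativeSemigroupProperties
import Algebra.Properties.Ring as RingProperties
import Algebra.Solver.Ring as RingSolver
import Algebra.Solver.Ring.AlmostCommutativeRing as ACR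
open import Data.Integer as ℤ using (ℤ; +_; -[1+_])
import Data.Integer.Properties as ℤ
open import Data.Maybe using (Maybe; just; nothing)
open import Data.Nat as ℕ using (ℕ; zero; suc; _≤_; _<_; z≤n; s≤s)
open import Data.Nat.Induction using (<-rec)
import Data.Nat.Properties as ℕ
open import Data.Product using (proj₁; proj₂)
open import Data.Sign as Sign using (Sign)
open import Data.Sum using (inj₁; inj₂)
open import Relation.Binary.Definitions using (tri<; tri≈; tri>)
open import Relation.Binary.PropositionalEquality as ≡ using (_≢_)
open import Relation.Nullary using (¬_; yes; no; contradiction)

open import Defs

-- The ring solver over an abstract commutative ring needs coefficients whose
-- equality computes; we take them from ℤ via its canonical map into R.
module IntegerCoefficients {c ℓ} (R : CommutativeRing c ℓ) where
  open CommutativeRing R hiding (zero)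
  open RingProperties ring
  open import Relation.Binary.Reasoning.Setoid setoid

  ι-homo-+ : ∀ a b → ι R (a ℕ.+ b) ≈ ι R a + ι R b
  ι-homo-+ zero    b = sym (+-identityˡ _)
  ι-homo-+ (suc a) b = trans (+-congˡ (ι-homo-+ a b)) (sym (+-assoc _ _ _))

  ι-homo-* : ∀ a b → ι R (a ℕ.* b) ≈ ι R a * ι R b
  ι-homo-* zero    b = sym (zeroˡ _)
  ι-homo-* (suc a) b = begin
    ι R (b ℕ.+ a ℕ.* b)          ≈⟨ ι-homo-+ b (a ℕ.* b) ⟩
    ι R b + ι R (a ℕ.* b)        ≈⟨ +-cong (sym (*-identityˡ _)) (ι-homo-* a b) ⟩
    1# * ι R b + ι R a * ι R b   ≈⟨ distribʳ _ _ _ ⟨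
    (1# + ι R a) * ι R b         ∎

  fromℤ : ℤ → Carrier
  fromℤ (+ n)    = ι R n
  fromℤ -[1+ n ] = - ι R (suc n)

  fromℤ-⊖ : ∀ a b → fromℤ (a ℤ.⊖ b) ≈ ι R a - ι R b
  fromℤ-⊖ zero    zero    = sym (trans (+-congˡ -0#≈0#) (+-identityʳ _))
  fromℤ-⊖ zero    (suc b) = sym (+-identityˡ _)
  fromℤ-⊖ (suc a) zero    = sym (trans (+-congˡ -0#≈0#) (+-identityʳ _))
  fromℤ-⊖ (suc a) (suc b) = begin
    fromℤ (suc a ℤ.⊖ suc b)        ≡⟨ ≡.cong fromℤ (ℤ.[1+m]⊖[1+n]≡m⊖n a b) ⟩
    fromℤ (a ℤ.⊖ b)                ≈⟨ fromℤ-⊖ a b ⟩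
    ι R a - ι R b                  ≈⟨ xyx⁻¹≈y 1# _ ⟨
    1# + (ι R a - ι R b) - 1#      ≈⟨ +-congʳ (sym (+-assoc _ _ _)) ⟩
    ι R (suc a) - ι R b - 1#       ≈⟨ +-assoc _ _ _ ⟩
    ι R (suc a) + (- ι R b - 1#)   ≈⟨ +-congˡ (-‿+-comm _ _) ⟩
    ι R (suc a) - (ι R b + 1#)     ≈⟨ +-congˡ (-‿cong (+-comm _ _)) ⟩
    ι R (suc a) - ι R (suc b)      ∎

  fromℤ-homo-- : ∀ i → fromℤ (ℤ.- i) ≈ - fromℤ i
  fromℤ-homo-- -[1+ n ]    = sym (-‿involutive _)
  fromℤ-homo-- (+ zero)    = sym -0#≈0#
  fromℤ-homo-- (+ suc n)   = refl

  fromℤ-homo-+ : ∀ i j → fromℤ (i ℤ.+ j) ≈ fromℤ i + fromℤ j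
  fromℤ-homo-+ -[1+ m ] -[1+ n ] = begin
    - ι R (suc (suc (m ℕ.+ n)))      ≡⟨ ≡.cong (λ k → - ι R (suc k)) (ℕ.+-suc m n) ⟨
    - ι R (suc m ℕ.+ suc n)          ≈⟨ -‿cong (ι-homo-+ (suc m) (suc n)) ⟩
    - (ι R (suc m) + ι R (suc n))    ≈⟨ -‿+-comm _ _ ⟨
    - ι R (suc m) - ι R (suc n)      ∎
  fromℤ-homo-+ -[1+ m ] (+ n)    = trans (fromℤ-⊖ n (suc m)) (+-comm _ _)
  fromℤ-homo-+ (+ m)    -[1+ n ] = fromℤ-⊖ m (suc n)
  fromℤ-homo-+ (+ m)    (+ n)    = ι-homo-+ m n

  private
    signed : Sign → Carrier → Carrier
    signed Sign.+ x = x
    signed Sign.- x = - x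

    fromℤ-◃ : ∀ s n → fromℤ (s ℤ.◃ n) ≈ signed s (ι R n)
    fromℤ-◃ Sign.+ zero    = refl
    fromℤ-◃ Sign.- zero    = sym -0#≈0#
    fromℤ-◃ Sign.+ (suc n) = refl
    fromℤ-◃ Sign.- (suc n) = refl

  fromℤ-homo-* : ∀ i j → fromℤ (i ℤ.* j) ≈ fromℤ i * fromℤ j
  fromℤ-homo-* -[1+ m ] -[1+ n ] = begin
    fromℤ (Sign.+ ℤ.◃ (suc m ℕ.* suc n)) ≈⟨ fromℤ-◃ Sign.+ (suc m ℕ.* suc n) ⟩
    ι R (suc m ℕ.* suc n)                ≈⟨ ι-homo-* (suc m) (suc n) ⟩
    ι R (suc m) * ι R (suc n)            ≈⟨ -‿involutive _ ⟨
    - - (ι R (suc m) * ι R (suc n))      ≈⟨ -‿cong (-‿distribʳ-* _ _) ⟩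
    - (ι R (suc m) * - ι R (suc n))      ≈⟨ -‿distribˡ-* _ _ ⟩
    - ι R (suc m) * - ι R (suc n)        ∎
  fromℤ-homo-* -[1+ m ] (+ n) = begin
    fromℤ (Sign.- ℤ.◃ (suc m ℕ.* n))     ≈⟨ fromℤ-◃ Sign.- (suc m ℕ.* n) ⟩
    - ι R (suc m ℕ.* n)                  ≈⟨ -‿cong (ι-homo-* (suc m) n) ⟩
    - (ι R (suc m) * ι R n)              ≈⟨ -‿distribˡ-* _ _ ⟩
    - ι R (suc m) * ι R n                ∎
  fromℤ-homo-* (+ m) -[1+ n ] = begin
    fromℤ (Sign.- ℤ.◃ (m ℕ.* suc n))     ≈⟨ fromℤ-◃ Sign.- (m ℕ.* suc n) ⟩
    - ι R (m ℕ.* suc n)                  ≈⟨ -‿cong (ι-homo-* m (suc n)) ⟩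
    - (ι R m * ι R (suc n))              ≈⟨ -‿distribʳ-* _ _ ⟩
    ι R m * - ι R (suc n)                ∎
  fromℤ-homo-* (+ m) (+ n) = trans (fromℤ-◃ Sign.+ (m ℕ.* n)) (ι-homo-* m n)

  fromℤ-homomorphism : CommutativeRing.rawRing ℤ.+-*-commutativeRing
                         ACR.-Raw-AlmostCommutative⟶ ACR.fromCommutativeRing R
  fromℤ-homomorphism = record
    { ⟦_⟧    = fromℤ
    ; +-homo = fromℤ-homo-+
    ; *-homo = fromℤ-homo-*
    ; -‿homo = fromℤ-homo--
    ; 0-homo = refl
    ; 1-homo = +-identityʳ 1#
    }

  fromℤ-≟ : ∀ i j → Maybe (fromℤ i ≈ fromℤ j)
  fromℤ-≟ i j with i ℤ.≟ j
  ... | yes ≡.refl = just refl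
  ... | no _       = nothing

  open RingSolver (CommutativeRing.rawRing ℤ.+-*-commutativeRing)
    (ACR.fromCommutativeRing R) fromℤ-homomorphism fromℤ-≟ public

module Sums {c ℓ} (R : CommutativeRing c ℓ) where
  open CommutativeRing R hiding (zero)
  open RingProperties ring using (-‿+-comm)
  open CommutativeSemigroupProperties +-commutativeSemigroup using (interchange)
  open import Relation.Binary.Reasoning.Setoid setoid

  sumTo-cong : ∀ N {g h : ℕ → Carrier} → (∀ k → g k ≈ h k) → sumTo R N g ≈ sumTo R N h
  sumTo-cong zero    g≈h = g≈h 0
  sumTo-cong (suc N) g≈h = +-cong (sumTo-cong N g≈h) (g≈h (suc N))

  sumTo-distrib-+ : ∀ N (g h : ℕ → Carrier) →
                    sumTo R N (λ k → g k + h k) ≈ sumTo R N g + sumTo R N h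
  sumTo-distrib-+ zero    g h = refl
  sumTo-distrib-+ (suc N) g h =
    trans (+-congʳ (sumTo-distrib-+ N g h)) (interchange _ _ _ _)

  sumTo-distrib-- : ∀ N (g h : ℕ → Carrier) →
                    sumTo R N (λ k → g k - h k) ≈ sumTo R N g - sumTo R N h
  sumTo-distrib-- zero    g h = refl
  sumTo-distrib-- (suc N) g h = begin
    sumTo R N (λ k → g k - h k) + (g (suc N) - h (suc N))
      ≈⟨ +-congʳ (sumTo-distrib-- N g h) ⟩
    (sumTo R N g - sumTo R N h) + (g (suc N) - h (suc N))
      ≈⟨ interchange _ _ _ _ ⟩
    sumTo R (suc N) g + (- sumTo R N h - h (suc N))
      ≈⟨ +-congˡ (-‿+-comm _ _) ⟩
    sumTo R (suc N) g - sumTo R (suc N) h ∎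

  sumTo-distribʳ-* : ∀ N (g : ℕ → Carrier) z →
                     sumTo R N (λ k → g k * z) ≈ sumTo R N g * z
  sumTo-distribʳ-* zero    g z = refl
  sumTo-distribʳ-* (suc N) g z =
    trans (+-congʳ (sumTo-distribʳ-* N g z)) (sym (distribʳ _ _ _))

  sumTo-suc : ∀ N (g : ℕ → Carrier) → sumTo R (suc N) g ≈ g 0 + sumTo R N (λ k → g (suc k))
  sumTo-suc zero    g = refl
  sumTo-suc (suc N) g = trans (+-congʳ (sumTo-suc N g)) (+-assoc _ _ _)

  sumTo-zero : ∀ N (g : ℕ → Carrier) → (∀ i → i ≤ N → g i ≈ 0#) → sumTo R N g ≈ 0#
  sumTo-zero zero    g g≈0 = g≈0 0 z≤n
  sumTo-zero (suc N) g g≈0 = begin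
    sumTo R N g + g (suc N)
      ≈⟨ +-cong (sumTo-zero N g (λ i i≤N → g≈0 i (ℕ.m≤n⇒m≤1+n i≤N))) (g≈0 (suc N) ℕ.≤-refl) ⟩
    0# + 0#
      ≈⟨ +-identityʳ 0# ⟩
    0# ∎

  sumTo-single : ∀ N (g : ℕ → Carrier) j → j ≤ N → (∀ i → i ≢ j → g i ≈ 0#) →
                 sumTo R N g ≈ g j
  sumTo-single zero    g .zero z≤n _ = refl
  sumTo-single (suc N) g j j≤1+N g≈0 with ℕ.m≤n⇒m<n∨m≡n j≤1+N
  ... | inj₁ (s≤s j≤N) =
    trans (+-cong (sumTo-single N g j j≤N g≈0) (g≈0 (suc N) (ℕ.>⇒≢ (s≤s j≤N))))
          (+-identityʳ _)
  ... | inj₂ ≡.refl =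
    trans (+-congʳ (sumTo-zero N g (λ i i≤N → g≈0 i (ℕ.<⇒≢ (s≤s i≤N)))))
          (+-identityˡ _)

  sumTo-shift-+ : ∀ N (a b : ℕ → Carrier) → a 0 ≈ 0# → b (suc N) ≈ 0# →
                  sumTo R (suc N) (λ k → a k + b k) ≈ sumTo R N (λ k → a (suc k) + b k)
  sumTo-shift-+ N a b a₀≈0 bₙ≈0 = begin
    sumTo R (suc N) (λ k → a k + b k)
      ≈⟨ sumTo-distrib-+ (suc N) a b ⟩
    sumTo R (suc N) a + (sumTo R N b + b (suc N))
      ≈⟨ +-cong (sumTo-suc N a) (+-congˡ bₙ≈0) ⟩
    (a 0 + sumTo R N (λ k → a (suc k))) + (sumTo R N b + 0#)
      ≈⟨ +-cong (trans (+-congʳ a₀≈0) (+-identityˡ _)) (+-identityʳ _) ⟩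
    sumTo R N (λ k → a (suc k)) + sumTo R N b
      ≈⟨ sumTo-distrib-+ N (λ k → a (suc k)) b ⟨
    sumTo R N (λ k → a (suc k) + b k) ∎

module FallingFactorial {c ℓ} (R : CommutativeRing c ℓ) where
  open CommutativeRing R hiding (zero)
  open RingProperties ring using (xyx⁻¹≈y)
  open IntegerCoefficients R using (ι-homo-+)
  open import Relation.Binary.Reasoning.Setoid setoid

  ι-∸ : ∀ {i j} → i ≤ j → ι R j - ι R i ≈ ι R (j ℕ.∸ i)
  ι-∸ {i} {j} i≤j = begin
    ι R j - ι R i                          ≡⟨ ≡.cong (λ n → ι R n - ι R i) (ℕ.m+[n∸m]≡n i≤j) ⟨
    ι R (i ℕ.+ (j ℕ.∸ i)) - ι R i          ≈⟨ +-congʳ (ι-homo-+ i (j ℕ.∸ i)) ⟩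
    ι R i + ι R (j ℕ.∸ i) - ι R i          ≈⟨ xyx⁻¹≈y _ _ ⟩
    ι R (j ℕ.∸ i)                          ∎

  fall-ι-vanishes : ∀ {i j} → j < i → fall R (ι R j) i ≈ 0#
  fall-ι-vanishes {suc i} {j} (s≤s j≤i) with ℕ.m≤n⇒m<n∨m≡n j≤i
  ... | inj₁ j<i   = trans (*-congʳ (fall-ι-vanishes j<i)) (zeroˡ _)
  ... | inj₂ ≡.refl =
    trans (*-congˡ (trans (+-congˡ (-‿cong (*-identityʳ _))) (-‿inverseʳ _))) (zeroʳ _)

module IntegralDomain {c ℓ} (R : CommutativeRing c ℓ) (domain : IntegralDomainChar0 R) where
  open CommutativeRing R hiding (zero)
  open RingProperties ring using ([y-z]x≈yx-zx; x≈y⇒x∙y⁻¹≈ε; x∙y⁻¹≈ε⇒x≈y)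
  open Sums R
  open FallingFactorial R
  open import Relation.Binary.Reasoning.Setoid setoid

  ι-nonzero : ∀ {n} → 0 < n → ¬ ι R n ≈ 0#
  ι-nonzero {suc n} _ = proj₂ domain n

  1≉0 : ¬ 1# ≈ 0#
  1≉0 1≈0 = ι-nonzero {1} (s≤s z≤n) (trans (+-identityʳ 1#) 1≈0)

  *-nonzero : ∀ {x y} → ¬ x ≈ 0# → ¬ y ≈ 0# → ¬ x * y ≈ 0#
  *-nonzero x≉0 y≉0 xy≈0 with proj₁ domain _ _ xy≈0
  ... | inj₁ x≈0 = x≉0 x≈0
  ... | inj₂ y≈0 = y≉0 y≈0

  x*y≈0⇒x≈0 : ∀ {x y} → ¬ y ≈ 0# → x * y ≈ 0# → x ≈ 0#
  x*y≈0⇒x≈0 y≉0 xy≈0 with proj₁ domain _ _ xy≈0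
  ... | inj₁ x≈0 = x≈0
  ... | inj₂ y≈0 = contradiction y≈0 y≉0

  *-cancelʳ-nonzero : ∀ {x y z} → ¬ z ≈ 0# → x * z ≈ y * z → x ≈ y
  *-cancelʳ-nonzero {x} {y} {z} z≉0 xz≈yz = x∙y⁻¹≈ε⇒x≈y x y
    (x*y≈0⇒x≈0 z≉0 (trans ([y-z]x≈yx-zx z x y) (x≈y⇒x∙y⁻¹≈ε xz≈yz)))

  pow-nonzero : ∀ {x} → ¬ x ≈ 0# → ∀ k → ¬ pow R x k ≈ 0#
  pow-nonzero x≉0 zero    = 1≉0
  pow-nonzero x≉0 (suc k) = *-nonzero (pow-nonzero x≉0 k) x≉0

  fall-ι-nonzero : ∀ {i j} → i ≤ j → ¬ fall R (ι R j) i ≈ 0#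
  fall-ι-nonzero {zero}  _   = 1≉0
  fall-ι-nonzero {suc i} {j} i<j = *-nonzero (fall-ι-nonzero {i} {j} (ℕ.<⇒≤ i<j)) last≉0
    where
    last≉0 : ¬ ι R j - ι R i * 1# ≈ 0#
    last≉0 e = ι-nonzero (ℕ.m<n⇒0<n∸m i<j)
      (trans (sym (ι-∸ (ℕ.<⇒≤ i<j))) (trans (+-congˡ (-‿cong (sym (*-identityʳ _)))) e))

  fall-linearIndependent : ∀ N (d : ℕ → Carrier) →
                           (∀ x → sumTo R N (λ i → d i * fall R x i) ≈ 0#) →
                           ∀ i → i ≤ N → d i ≈ 0#
  fall-linearIndependent N d sum≈0 = <-rec (λ i → i ≤ N → d i ≈ 0#) step
    where
    step : ∀ j → (∀ {i} → i < j → i ≤ N → d i ≈ 0#) → j ≤ N → d j ≈ 0#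
    step j earlier≈0 j≤N = x*y≈0⇒x≈0 (fall-ι-nonzero {j} {j} ℕ.≤-refl)
      (trans (sym (sumTo-single N term j j≤N others≈0)) (sum≈0 (ι R j)))
      where
      term : ℕ → Carrier
      term i = d i * fall R (ι R j) i
      others≈0 : ∀ i → i ≢ j → term i ≈ 0#
      others≈0 i i≢j with ℕ.<-cmp i j
      ... | tri< i<j _ _ = trans (*-congʳ (earlier≈0 i<j (ℕ.<⇒≤ (ℕ.<-≤-trans i<j j≤N)))) (zeroˡ _)
      ... | tri≈ _ i≡j _ = contradiction i≡j i≢j
      ... | tri> _ _ j<i = trans (*-congˡ (fall-ι-vanishes j<i)) (zeroʳ _)

  fall-coefficients-unique : ∀ N (a b : ℕ → Carrier) →
                             (∀ x → sumTo R N (λ i → a i * fall R x i)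
                                  ≈ sumTo R N (λ i → b i * fall R x i)) →
                             ∀ i → i ≤ N → a i ≈ b i
  fall-coefficients-unique N a b sums≈ i i≤N =
    x∙y⁻¹≈ε⇒x≈y _ _ (fall-linearIndependent N (λ i → a i - b i) difference≈0 i i≤N)
    where
    difference≈0 : ∀ x → sumTo R N (λ i → (a i - b i) * fall R x i) ≈ 0#
    difference≈0 x = begin
      sumTo R N (λ i → (a i - b i) * fall R x i)
        ≈⟨ sumTo-cong N (λ i → [y-z]x≈yx-zx (fall R x i) (a i) (b i)) ⟩
      sumTo R N (λ i → a i * fall R x i - b i * fall R x i)
        ≈⟨ sumTo-distrib-- N _ _ ⟩
      sumTo R N (λ i → a i * fall R x i) - sumTo R N (λ i → b i * fall R x i)
        ≈⟨ x≈y⇒x∙y⁻¹≈ε (sums≈ x) ⟩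
      0# ∎

module DegenerateWhitney {c ℓ} (R : CommutativeRing c ℓ) (m : ℕ) (lam : CommutativeRing.Carrier R)
         (W : ℕ → ℕ → CommutativeRing.Carrier R) (isW : IsDegWhitney2 R m lam W) where
  open CommutativeRing R hiding (zero)
  open IntegerCoefficients R using (solve; _:+_; _:-_; _:*_; _:=_)
  open Sums R
  open import Relation.Binary.Reasoning.Setoid setoid

  recurrence : ℕ → ℕ → Carrier
  recurrence n k = Wpred R W n k + (ι R m * ι R k + 1#) * W n k - lam * ι R n * W n k

  sumTo-recurrence : ∀ n x →
    sumTo R (suc n) (λ k → recurrence n k * pow R (ι R m) k * fall R x k)
      ≈ fallλ R (ι R m * x + 1#) lam (suc n)
  sumTo-recurrence n x = begin
    sumTo R (suc n) (λ k → recurrence n k * p k * fall R x k)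
      ≈⟨ sumTo-cong (suc n) split ⟩
    sumTo R (suc n) (λ k → lowered k + kept k)
      ≈⟨ sumTo-shift-+ n lowered kept lowered₀≈0 keptₙ₊₁≈0 ⟩
    sumTo R n (λ k → lowered (suc k) + kept k)
      ≈⟨ sumTo-cong n multiplied ⟩
    sumTo R n (λ k → W n k * p k * fall R x k * (y - ι R n * lam))
      ≈⟨ sumTo-distribʳ-* n (λ k → W n k * p k * fall R x k) _ ⟩
    sumTo R n (λ k → W n k * p k * fall R x k) * (y - ι R n * lam)
      ≈⟨ *-congʳ (proj₂ isW n x) ⟨
    fallλ R y lam (suc n) ∎
    where
    M y : Carrier
    M = ι R m
    y = M * x + 1#
    p : ℕ → Carrier
    p = pow R M

    lowered kept : ℕ → Carrier
    lowered k = Wpred R W n k * p k * fall R x k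
    kept k = ((M * ι R k + 1#) - lam * ι R n) * W n k * p k * fall R x k

    split : ∀ k → recurrence n k * p k * fall R x k ≈ lowered k + kept k
    split k = solve 9 (λ W′ Ik Wn pk fk M′ l In one →
        (W′ :+ (M′ :* Ik :+ one) :* Wn :- l :* In :* Wn) :* pk :* fk
          := W′ :* pk :* fk :+ ((M′ :* Ik :+ one) :- l :* In) :* Wn :* pk :* fk)
      refl (Wpred R W n k) (ι R k) (W n k) (p k) (fall R x k) M lam (ι R n) 1#

    lowered₀≈0 : lowered 0 ≈ 0#
    lowered₀≈0 = trans (*-congʳ (zeroˡ _)) (zeroˡ _)

    keptₙ₊₁≈0 : kept (suc n) ≈ 0#
    keptₙ₊₁≈0 = begin
      _ * W n (suc n) * p (suc n) * fall R x (suc n)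
        ≈⟨ *-congʳ (*-congʳ (*-congˡ (proj₁ isW n (suc n) (ℕ.n<1+n n)))) ⟩
      _ * 0# * p (suc n) * fall R x (suc n)         ≈⟨ *-congʳ (*-congʳ (zeroʳ _)) ⟩
      0# * p (suc n) * fall R x (suc n)             ≈⟨ *-congʳ (zeroˡ _) ⟩
      0# * fall R x (suc n)                         ≈⟨ zeroˡ _ ⟩
      0# ∎

    multiplied : ∀ k → lowered (suc k) + kept k ≈ W n k * p k * fall R x k * (y - ι R n * lam)
    multiplied k = begin
      W n k * (p k * M) * (fall R x k * (x - ι R k * 1#)) + kept k
        ≈⟨ +-congʳ (*-congˡ (*-congˡ (+-congˡ (-‿cong (*-identityʳ _))))) ⟩
      W n k * (p k * M) * (fall R x k * (x - ι R k)) + kept k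
        ≈⟨ solve 9 (λ Wn pk M′ fk x′ Ik one l In →
             Wn :* (pk :* M′) :* (fk :* (x′ :- Ik)) :+ ((M′ :* Ik :+ one) :- l :* In) :* Wn :* pk :* fk
               := Wn :* pk :* fk :* ((M′ :* x′ :+ one) :- In :* l))
           refl (W n k) (p k) M (fall R x k) x (ι R k) 1# lam (ι R n) ⟩
      W n k * p k * fall R x k * (y - ι R n * lam) ∎

-- The recurrence holds for every λ.
theorem6 : ∀ {c ℓ} (R : CommutativeRing c ℓ) → IntegralDomainChar0 R →
    (m : ℕ) → 1 ≤ m → (lam : CommutativeRing.Carrier R) →
    ¬ (CommutativeRing._≈_ R lam (CommutativeRing.0# R)) →
    (W : ℕ → ℕ → CommutativeRing.Carrier R) → IsDegWhitney2 R m lam W →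
    ∀ n k → k ≤ suc n →
    let open CommutativeRing R in
    W (suc n) k ≈ Wpred R W n k + (ι R m * ι R k + 1#) * W n k - lam * ι R n * W n k
theorem6 R domain m 1≤m lam _ W isW n k k≤1+n =
  *-cancelʳ-nonzero (pow-nonzero (ι-nonzero 1≤m) k)
    (fall-coefficients-unique (suc n) _ _
      (λ x → trans (sym (proj₂ isW (suc n) x)) (sym (sumTo-recurrence n x))) k k≤1+n)
  where
  open CommutativeRing R using (sym; trans)
  open IntegralDomain R domain
  open DegenerateWhitney R m lam W isW
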